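{- Let $k\in\mathbb{Z}$ and $n,m\in \mathbb{Z}^+$ with $n,m\geq 2$ and $k\not\equiv 0 \pmod n$, and let $P_m$ be the path on $m$ vertices. Then $\chi_{(n,k)}(P_2)=2$; \[ \chi_{(n,k)}(P_3) = \begin{cases} 2, & \text{if } (2,n) \mid k,\\ 3, & \text{otherwise};\end{cases}\] $\chi_{(n,k)}(P_4)=3$; and for $m\geq 5$, \[ \chi_{(n,k)}(P_m) = \begin{cases} 3, & \text{if } m\equiv 3 \pmod 4 \text{ and } (2,n) \mid k,\\ \text{does not exist}, & \text{if } m\equiv 1 \pmod 4, \\ 4, & \text{otherwise}. \end{cases}\]
   Context: $(a,b)$ denotes the greatest common divisor. For a graph $G=(V,E)$, a $\mathbb{Z}$-labeling is a map $\ell:V\to\mathbb{Z}$; its order is the size of its range; it is proper if adjacent vertices get different labels. $N(v)$ is the open neighborhood of $v$. An open coloring with remainder $k \bmod n$ is a labeling with $\sum_{w\in N(v)}\ell(w)\equiv k \pmod n$ for all $v\in V$. If no proper such coloring exists, $\chi_{(n,k)}(G)$ does not exist; otherwise $\chi_{(n,k)}(G)$ is the minimum order of a proper open coloring with remainder $k\bmod n$. -}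

module Defs where

open import Data.Nat using (ℕ; zero; suc; _≤_; _≡ᵇ_)
open import Data.Nat.GCD using (gcd)
open import Data.Fin using (Fin; zero; suc; toℕ)
open import Data.Integer using (ℤ; +_; _+_; _-_)
open import Data.Integer.Divisibility using (_∣_)
open import Data.Bool using (Bool; true; false; if_then_else_; _∨_)
open import Data.Product using (Σ; ∃; _×_; _,_)
open import Relation.Binary.PropositionalEquality using (_≡_; _≢_)
open import Relation.Nullary using (¬_)
open import Function.Definitions using (Injective)

record Graph : Set where
  field
    size : ℕ
    adj  : Fin size → Fin size → Bool
open Graph public

sumFin : (N : ℕ) → (Fin N → ℤ) → ℤ
sumFin zero    f = + 0
sumFin (suc N) f = f zero + sumFin N (λ i → f (suc i))

nbSum : (G : Graph) → (Fin (size G) → ℤ) → Fin (size G) → ℤ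
nbSum G ℓ v = sumFin (size G) (λ w → if adj G v w then ℓ w else + 0)

_≡_[mod_] : ℤ → ℤ → ℕ → Set
a ≡ b [mod n ] = (+ n) ∣ (a - b)

HasOrder : {N : ℕ} → (Fin N → ℤ) → ℕ → Set
HasOrder {N} ℓ r =
  Σ (Fin r → ℤ) λ f → Injective _≡_ _≡_ f
    × (∀ v → ∃ λ i → ℓ v ≡ f i)
    × (∀ i → ∃ λ v → f i ≡ ℓ v)

Proper : (G : Graph) → (Fin (size G) → ℤ) → Set
Proper G ℓ = ∀ v w → adj G v w ≡ true → ℓ v ≢ ℓ w

OpenColoring : ℕ → ℤ → (G : Graph) → (Fin (size G) → ℤ) → Set
OpenColoring n k G ℓ = ∀ v → nbSum G ℓ v ≡ k [mod n ]

ProperOpenColoring : ℕ → ℤ → (G : Graph) → (Fin (size G) → ℤ) → Set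
ProperOpenColoring n k G ℓ = Proper G ℓ × OpenColoring n k G ℓ

ChiEq : ℕ → ℤ → Graph → ℕ → Set
ChiEq n k G c =
  (∃ λ ℓ → ProperOpenColoring n k G ℓ × HasOrder ℓ c)
  × (∀ ℓ r → ProperOpenColoring n k G ℓ → HasOrder ℓ r → c ≤ r)

ChiDNE : ℕ → ℤ → Graph → Set
ChiDNE n k G = ∀ ℓ → ¬ ProperOpenColoring n k G ℓ

Path : ℕ → Graph
Path m = record
  { size = m
  ; adj  = λ i j → (suc (toℕ i) ≡ᵇ toℕ j) ∨ (suc (toℕ j) ≡ᵇ toℕ i) }

{-# OPTIONS --safe #-}
module Submission where

open import Defs
open import Data.Nat using (ℕ; _≤_; _%_)
open import Data.Nat.GCD using (gcd)
open import Data.Integer using (ℤ; +_)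
open import Data.Integer.Divisibility using (_∣_)
open import Data.Product using (_×_)
open import Relation.Binary.PropositionalEquality using (_≡_)
open import Relation.Nullary using (¬_)

import Data.Nat as ℕ
open import Data.Nat using (zero; suc; _<_; _≡ᵇ_; _≤?_; z≤n; s≤s)
open import Data.Nat.Properties using (≡ᵇ⇒≡; +-comm; ≤-refl; m+n≤o⇒n≤o; m≤n⇒m<n∨m≡n)
open import Data.Nat.DivMod using ([m+n]%n≡m%n; m%n<n)
open import Data.Nat.GCD using (gcd[m,n]∣m; gcd[m,n]∣n; gcd-GCD; module Bézout)
open import Data.Integer using (-_; _+_; _-_; _*_)
import Data.Integer.Properties as ℤ
import Data.Integer.Divisibility.Signed as Signed
open import Data.Integer.Divisibility.Signed using (∣ᵤ⇒∣; ∣⇒∣ᵤ)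
open import Data.Integer.Tactic.RingSolver using (solve-∀)
open import Data.Fin using (Fin; zero; suc; toℕ; fromℕ<)
open import Data.Fin.Properties using (toℕ<n; toℕ-fromℕ<; injective⇒≤)
open import Data.Bool using (true; false; if_then_else_; _∨_)
open import Data.Bool.Properties using (T-≡; T-∨)
open import Data.List using (List; []; _∷_; length; lookup)
open import Data.List.Membership.Propositional using (_∈_)
open import Data.List.Membership.Propositional.Properties using (∈-lookup)
import Data.List.Relation.Unary.All as All
open import Data.List.Relation.Unary.All using (All; []; _∷_)
open import Data.List.Relation.Unary.Any using (here; there; index)
open import Data.List.Relation.Unary.Any.Properties using (lookup-index)
open import Data.List.Relation.Unary.Unique.Propositional using (Unique; []; _∷_)
open import Data.Product using (∃; _,_; proj₁; proj₂)
import Data.Sum as Sum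
open import Data.Sum using (_⊎_; inj₁; inj₂; [_,_]′)
open import Data.Empty using (⊥-elim)
open import Function using (_∘_; Equivalence)
open import Function.Definitions using (Injective)
open import Level using (0ℓ)
open import Relation.Binary.Bundles using (Setoid)
import Relation.Binary.Reasoning.Setoid
open import Relation.Binary.PropositionalEquality using (_≢_; ≢-sym; refl; sym; trans; cong; subst)
open import Relation.Nullary using (Dec; yes; no)
open import Relation.Nullary.Decidable using (True; toWitness)

-- Read a labeling of P_m as a sequence x₀, …, x_{m-1} and pad it with x_m = 0 (this is extend).
-- The open condition then says x₁ ≡ k and x_i + x_{i+2} ≡ k (mod n) at every inner vertex, so
-- modulo n the sequence is forced to be the 4-periodic  a, k, k - a, 0, a, …  with a = x₀
-- (openPattern a), and the only remaining constraint is that this pattern vanishes at the padding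
-- index m.  For m ≡ 1 (mod 4) that reads k ≡ 0, so no open coloring exists; it forces a ≡ 0 for
-- m ≡ 0 and a ≡ k for m ≡ 2, and is void for m ≡ 3.  Adjacent labels differ, labels with different
-- residues differ, and x_i = x_{i+2} forces k ≡ 0 for odd i and 2a ≡ k for even i, where 2a ≡ k is
-- solvable iff gcd(2, n) ∣ k.  This gives the lower bounds; the matching colorings repeat
-- 0, k, k + n, n  or  k, k + n, 0, n  (or a, k, a, 0 with 2a ≡ k).

extend : ∀ {m} → (Fin m → ℤ) → ℕ → ℤ
extend {zero}  ℓ j       = + 0
extend {suc m} ℓ zero    = ℓ zero
extend {suc m} ℓ (suc j) = extend (ℓ ∘ suc) j

restrict : ∀ {m} → (ℕ → ℤ) → Fin m → ℤ
restrict x v = x (toℕ v)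

previous : (ℕ → ℤ) → ℕ → ℤ
previous x zero    = + 0
previous x (suc i) = x i

extend-length : ∀ {m} (ℓ : Fin m → ℤ) → extend ℓ m ≡ + 0
extend-length {zero}  ℓ = refl
extend-length {suc m} ℓ = extend-length (ℓ ∘ suc)

extend-restrict : ∀ {m} (x : ℕ → ℤ) {j} → j < m → extend (restrict {m} x) j ≡ x j
extend-restrict {suc m} x {zero}  _         = refl
extend-restrict {suc m} x {suc j} (s≤s j<m) = extend-restrict {m} (x ∘ suc) j<m

sumFin-zero : ∀ N → sumFin N (λ _ → + 0) ≡ + 0
sumFin-zero zero    = refl
sumFin-zero (suc N) = trans (ℤ.+-identityˡ _) (sumFin-zero N)

-- The adjacency test between vertex 0 and vertex suc w, in normal form.
sumFin-first : ∀ m (ℓ : Fin m → ℤ) →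
               sumFin m (λ w → if (0 ≡ᵇ toℕ w) ∨ false then ℓ w else + 0) ≡ extend ℓ 0
sumFin-first zero    ℓ = refl
sumFin-first (suc m) ℓ = trans (cong (λ s → ℓ zero + s) (sumFin-zero m)) (ℤ.+-identityʳ (ℓ zero))

sumFin-adjacent : ∀ m (ℓ : Fin m → ℤ) t →
                  sumFin m (λ w → if (suc t ≡ᵇ toℕ w) ∨ (suc (toℕ w) ≡ᵇ t) then ℓ w else + 0)
                    ≡ previous (extend ℓ) t + extend ℓ (suc t)
sumFin-adjacent zero    ℓ zero          = refl
sumFin-adjacent zero    ℓ (suc t)       = refl
sumFin-adjacent (suc m) ℓ zero          = cong (λ s → + 0 + s) (sumFin-first m (ℓ ∘ suc))
sumFin-adjacent (suc m) ℓ (suc zero)    =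
  cong (λ s → ℓ zero + s) (trans (sumFin-adjacent m (ℓ ∘ suc) zero) (ℤ.+-identityˡ _))
sumFin-adjacent (suc m) ℓ (suc (suc t)) =
  trans (ℤ.+-identityˡ _) (sumFin-adjacent m (ℓ ∘ suc) (suc t))

nbSum-Path : ∀ m (ℓ : Fin m → ℤ) v →
             nbSum (Path m) ℓ v ≡ previous (extend ℓ) (toℕ v) + extend ℓ (suc (toℕ v))
nbSum-Path m ℓ v = sumFin-adjacent m ℓ (toℕ v)

Path-adj⇒consecutive : ∀ {m} (v w : Fin m) → adj (Path m) v w ≡ true →
                       toℕ w ≡ suc (toℕ v) ⊎ toℕ v ≡ suc (toℕ w)
Path-adj⇒consecutive v w e =
  Sum.map (sym ∘ ≡ᵇ⇒≡ _ _) (sym ∘ ≡ᵇ⇒≡ _ _) (Equivalence.to T-∨ (Equivalence.from T-≡ e))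

consecutive⇒proper : ∀ m (x : ℕ → ℤ) → (∀ i → suc i < m → x i ≢ x (suc i)) →
                     Proper (Path m) (restrict x)
consecutive⇒proper m x distinct v w e with Path-adj⇒consecutive v w e
... | inj₁ w≡1+v = λ eq →
  distinct (toℕ v) (subst (_< m) w≡1+v (toℕ<n w)) (trans eq (cong x w≡1+v))
... | inj₂ v≡1+w = λ eq →
  distinct (toℕ w) (subst (_< m) v≡1+w (toℕ<n v)) (trans (sym eq) (cong x v≡1+w))

InRange : ∀ {N} → (Fin N → ℤ) → ℤ → Set
InRange ℓ y = ∃ λ v → ℓ v ≡ y

lookup-injective : ∀ {xs : List ℤ} → Unique xs → Injective _≡_ _≡_ (lookup xs)
lookup-injective {x ∷ xs} (x∉xs ∷ u) {zero}  {zero}  _ = refl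
lookup-injective {x ∷ xs} (x∉xs ∷ u) {zero}  {suc j} e = ⊥-elim (All.lookup x∉xs (∈-lookup j) e)
lookup-injective {x ∷ xs} (x∉xs ∷ u) {suc i} {zero}  e = ⊥-elim (All.lookup x∉xs (∈-lookup i) (sym e))
lookup-injective {x ∷ xs} (x∉xs ∷ u) {suc i} {suc j} e = cong suc (lookup-injective u e)

length≤order : ∀ {N} {ℓ : Fin N → ℤ} {xs r} → Unique xs → All (InRange ℓ) xs →
               HasOrder ℓ r → length xs ≤ r
length≤order {ℓ = ℓ} {xs} {r} unique hits (f , _ , f-covers , _) = injective⇒≤ g-injective
  where
  hit : ∀ i → InRange ℓ (lookup xs i)
  hit i = All.lookup hits (∈-lookup i)
  g : Fin (length xs) → Fin r
  g i = proj₁ (f-covers (proj₁ (hit i)))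
  f∘g : ∀ i → f (g i) ≡ lookup xs i
  f∘g i = trans (sym (proj₂ (f-covers (proj₁ (hit i))))) (proj₂ (hit i))
  g-injective : Injective _≡_ _≡_ g
  g-injective {i} {j} e = lookup-injective unique (trans (sym (f∘g i)) (trans (cong f e) (f∘g j)))

enumeration⇒hasOrder : ∀ {N} {ℓ : Fin N → ℤ} {xs} → Unique xs → All (InRange ℓ) xs →
                       (∀ v → ℓ v ∈ xs) → HasOrder ℓ (length xs)
enumeration⇒hasOrder {xs = xs} unique hits covers =
  lookup xs , lookup-injective unique ,
  (λ v → index (covers v) , lookup-index (covers v)) ,
  (λ i → let hit = All.lookup hits (∈-lookup i) in proj₁ hit , sym (proj₂ hit))

edge⇒order≥2 : ∀ {G} {ℓ : Fin (size G) → ℤ} {u v r} → Proper G ℓ → adj G u v ≡ true →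
               HasOrder ℓ r → 2 ≤ r
edge⇒order≥2 {u = u} {v} proper uv =
  length≤order ((proper u v uv ∷ []) ∷ [] ∷ []) ((u , refl) ∷ (v , refl) ∷ [])

path⇒order≥3 : ∀ {G} {ℓ : Fin (size G) → ℤ} {u v w r} → Proper G ℓ →
               adj G u v ≡ true → adj G v w ≡ true → ℓ u ≢ ℓ w → HasOrder ℓ r → 3 ≤ r
path⇒order≥3 {u = u} {v} {w} proper uv vw u≢w =
  length≤order ((proper u v uv ∷ u≢w ∷ []) ∷ (proper v w vw ∷ []) ∷ [] ∷ [])
               ((u , refl) ∷ (v , refl) ∷ (w , refl) ∷ [])

repeat4 : ℤ → ℤ → ℤ → ℤ → ℕ → ℤ
repeat4 a b c d 0 = a
repeat4 a b c d 1 = b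
repeat4 a b c d 2 = c
repeat4 a b c d 3 = d
repeat4 a b c d (suc (suc (suc (suc j)))) = repeat4 a b c d j

repeat4-mod4 : ∀ a b c d j → repeat4 a b c d j ≡ repeat4 a b c d (j % 4)
repeat4-mod4 a b c d 0 = refl
repeat4-mod4 a b c d 1 = refl
repeat4-mod4 a b c d 2 = refl
repeat4-mod4 a b c d 3 = refl
repeat4-mod4 a b c d (suc (suc (suc (suc j)))) =
  trans (repeat4-mod4 a b c d j)
        (cong (repeat4 a b c d) (sym (trans (cong (_% 4) (+-comm 4 j)) ([m+n]%n≡m%n j 4))))

repeat4-∈ : ∀ {a b c d} {xs : List ℤ} → a ∈ xs → b ∈ xs → c ∈ xs → d ∈ xs →
            ∀ j → repeat4 a b c d j ∈ xs
repeat4-∈ a∈ b∈ c∈ d∈ 0 = a∈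
repeat4-∈ a∈ b∈ c∈ d∈ 1 = b∈
repeat4-∈ a∈ b∈ c∈ d∈ 2 = c∈
repeat4-∈ a∈ b∈ c∈ d∈ 3 = d∈
repeat4-∈ a∈ b∈ c∈ d∈ (suc (suc (suc (suc j)))) = repeat4-∈ a∈ b∈ c∈ d∈ j

repeat4-consecutive : ∀ {a b c d} → a ≢ b → b ≢ c → c ≢ d → d ≢ a →
                      ∀ j → repeat4 a b c d j ≢ repeat4 a b c d (suc j)
repeat4-consecutive a≢b b≢c c≢d d≢a 0 = a≢b
repeat4-consecutive a≢b b≢c c≢d d≢a 1 = b≢c
repeat4-consecutive a≢b b≢c c≢d d≢a 2 = c≢d
repeat4-consecutive a≢b b≢c c≢d d≢a 3 = d≢a
repeat4-consecutive a≢b b≢c c≢d d≢a (suc (suc (suc (suc j)))) =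
  repeat4-consecutive a≢b b≢c c≢d d≢a j

repeat4-proper : ∀ {m a b c d} → a ≢ b → b ≢ c → c ≢ d → d ≢ a →
                 Proper (Path m) (restrict (repeat4 a b c d))
repeat4-proper {m} {a} {b} {c} {d} a≢b b≢c c≢d d≢a =
  consecutive⇒proper m (repeat4 a b c d) (λ i _ → repeat4-consecutive a≢b b≢c c≢d d≢a i)

mod4-cases : ∀ m → m % 4 ≡ 0 ⊎ m % 4 ≡ 1 ⊎ m % 4 ≡ 2 ⊎ m % 4 ≡ 3
mod4-cases m with m % 4 | m%n<n m 4
... | 0 | _ = inj₁ refl
... | 1 | _ = inj₂ (inj₁ refl)
... | 2 | _ = inj₂ (inj₂ (inj₁ refl))
... | 3 | _ = inj₂ (inj₂ (inj₂ refl))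
... | suc (suc (suc (suc _))) | s≤s (s≤s (s≤s (s≤s ())))

pos-+-* : ∀ g u v w z → g ℕ.+ u ℕ.* v ≡ w ℕ.* z → + g + + u * + v ≡ + w * + z
pos-+-* g u v w z eq =
  trans (sym (trans (ℤ.pos-+ g (u ℕ.* v)) (cong (λ t → + g + t) (ℤ.pos-* u v))))
        (trans (cong +_ eq) (ℤ.pos-* w z))

module Congruence (n : ℕ) where

  -- A record rather than _≡_[mod_] itself, so that x and y can be inferred from x ≈ y.
  infix 4 _≈_
  record _≈_ (x y : ℤ) : Set where
    constructor congruent
    field ∣difference : + n Signed.∣ x - y

  open _≈_ public

  ≡[mod]⇒≈ : ∀ {x y} → x ≡ y [mod n ] → x ≈ y
  ≡[mod]⇒≈ = congruent ∘ ∣ᵤ⇒∣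

  ≈⇒≡[mod] : ∀ {x y} → x ≈ y → x ≡ y [mod n ]
  ≈⇒≡[mod] = ∣⇒∣ᵤ ∘ ∣difference

  private
    congruent-by : ∀ {x y d} → d ≡ x - y → + n Signed.∣ d → x ≈ y
    congruent-by refl = congruent

  ≈-refl : ∀ {x} → x ≈ x
  ≈-refl {x} = congruent-by (sym (ℤ.+-inverseʳ x)) (Signed.divides (+ 0) refl)

  ≈-reflexive : ∀ {x y} → x ≡ y → x ≈ y
  ≈-reflexive refl = ≈-refl

  ≈-sym : ∀ {x y} → x ≈ y → y ≈ x
  ≈-sym {x} {y} p = congruent-by (swap x y) (Signed.∣m⇒∣-m (∣difference p))
    where
    swap : ∀ x y → - (x - y) ≡ y - x
    swap = solve-∀

  ≈-trans : ∀ {x y z} → x ≈ y → y ≈ z → x ≈ z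
  ≈-trans {x} {y} {z} p q =
    congruent-by (telescope x y z) (Signed.∣m∣n⇒∣m+n (∣difference p) (∣difference q))
    where
    telescope : ∀ x y z → (x - y) + (y - z) ≡ x - z
    telescope = solve-∀

  +-cong : ∀ {x y u v} → x ≈ y → u ≈ v → x + u ≈ y + v
  +-cong {x} {y} {u} {v} p q =
    congruent-by (regroup x y u v) (Signed.∣m∣n⇒∣m+n (∣difference p) (∣difference q))
    where
    regroup : ∀ x y u v → (x - y) + (u - v) ≡ (x + u) - (y + v)
    regroup = solve-∀

  +-congˡ : ∀ z {x y} → x ≈ y → z + x ≈ z + y
  +-congˡ z = +-cong (≈-refl {z})

  +-congʳ : ∀ z {x y} → x ≈ y → x + z ≈ y + z
  +-congʳ z p = +-cong p (≈-refl {z})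

  -‿cong : ∀ {x y} → x ≈ y → - x ≈ - y
  -‿cong {x} {y} p = congruent-by (negate x y) (Signed.∣m⇒∣-m (∣difference p))
    where
    negate : ∀ x y → - (x - y) ≡ - x - - y
    negate = solve-∀

  *-congˡ : ∀ z {x y} → x ≈ y → z * x ≈ z * y
  *-congˡ z {x} {y} p = congruent-by (factor z x y) (Signed.∣n⇒∣m*n z (∣difference p))
    where
    factor : ∀ z x y → z * (x - y) ≡ z * x - z * y
    factor = solve-∀

  n≈0 : + n ≈ + 0
  n≈0 = congruent-by (sym (ℤ.+-identityʳ (+ n))) Signed.∣-refl

  ≈-setoid : Setoid 0ℓ 0ℓ
  ≈-setoid = record
    { Carrier       = ℤ
    ; _≈_           = _≈_
    ; isEquivalence = record { refl = ≈-refl ; sym = ≈-sym ; trans = ≈-trans }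
    }

  module ≈-Reasoning = Relation.Binary.Reasoning.Setoid ≈-setoid
  open ≈-Reasoning

  ≉⇒≢ : ∀ {x y} → ¬ x ≈ y → x ≢ y
  ≉⇒≢ x≉y refl = x≉y ≈-refl

  distinct-residues : ∀ {x y u v} → x ≈ u → y ≈ v → ¬ u ≈ v → x ≢ y
  distinct-residues x≈u y≈v u≉v =
    ≉⇒≢ (λ x≈y → u≉v (≈-trans (≈-sym x≈u) (≈-trans x≈y y≈v)))

  multiple≈0 : ∀ q → q * + n ≈ + 0
  multiple≈0 q = begin
    q * + n  ≈⟨ *-congˡ q n≈0 ⟩
    q * + 0  ≡⟨ ℤ.*-zeroʳ q ⟩
    + 0      ∎

  bézout : ∀ c → ∃ λ x → + c * x ≈ + gcd c n
  bézout c with Bézout.identity (gcd-GCD c n)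
  ... | Bézout.+- x y eq = + x , (begin
    + c * + x                            ≡⟨ ℤ.*-comm (+ c) (+ x) ⟩
    + x * + c                            ≡⟨ pos-+-* (gcd c n) y n x c eq ⟨
    + gcd c n + + y * + n                ≈⟨ +-congˡ (+ gcd c n) (multiple≈0 (+ y)) ⟩
    + gcd c n + + 0                      ≡⟨ ℤ.+-identityʳ _ ⟩
    + gcd c n                            ∎)
  ... | Bézout.-+ x y eq = - + x , (begin
    + c * - + x                          ≡⟨ cancel (+ gcd c n) (+ c) (+ x) ⟩
    + gcd c n - (+ gcd c n + + x * + c)  ≡⟨ cong (λ t → + gcd c n - t) (pos-+-* (gcd c n) x c y n eq) ⟩
    + gcd c n - + y * + n                ≈⟨ +-congˡ (+ gcd c n) (-‿cong (multiple≈0 (+ y))) ⟩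
    + gcd c n - + 0                      ≡⟨ ℤ.+-identityʳ _ ⟩
    + gcd c n                            ∎)
    where
    cancel : ∀ g c x → c * - x ≡ g - (g + x * c)
    cancel = solve-∀

  gcd∣⇒solvable : ∀ c {k} → + gcd c n ∣ k → ∃ λ a → + c * a ≈ k
  gcd∣⇒solvable c {k} g∣k with ∣ᵤ⇒∣ {+ gcd c n} {k} g∣k | bézout c
  ... | Signed.divides q refl | x , cx≈g = q * x , (begin
    + c * (q * x)   ≡⟨ reorder (+ c) q x ⟩
    q * (+ c * x)   ≈⟨ *-congˡ q cx≈g ⟩
    q * + gcd c n   ∎)
    where
    reorder : ∀ c q x → c * (q * x) ≡ q * (c * x)
    reorder = solve-∀

  solvable⇒gcd∣ : ∀ c {k a} → + c * a ≈ k → + gcd c n ∣ k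
  solvable⇒gcd∣ c {k} {a} ca≈k =
    ∣⇒∣ᵤ (subst (Signed._∣_ (+ gcd c n)) (difference (+ c * a) k)
      (Signed.∣m∣n⇒∣m-n (Signed.∣m⇒∣m*n {m = + c} a (∣ᵤ⇒∣ (gcd[m,n]∣m c n)))
                        (Signed.∣-trans (∣ᵤ⇒∣ (gcd[m,n]∣n c n)) (∣difference ca≈k))))
    where
    difference : ∀ x k → x - (x - k) ≡ k
    difference = solve-∀

  repeat4-cong : ∀ {a b c d a′ b′ c′ d′} → a ≈ a′ → b ≈ b′ → c ≈ c′ → d ≈ d′ →
                 ∀ j → repeat4 a b c d j ≈ repeat4 a′ b′ c′ d′ j
  repeat4-cong a≈ b≈ c≈ d≈ 0 = a≈
  repeat4-cong a≈ b≈ c≈ d≈ 1 = b≈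
  repeat4-cong a≈ b≈ c≈ d≈ 2 = c≈
  repeat4-cong a≈ b≈ c≈ d≈ 3 = d≈
  repeat4-cong a≈ b≈ c≈ d≈ (suc (suc (suc (suc j)))) = repeat4-cong a≈ b≈ c≈ d≈ j

module OpenColorings (n : ℕ) (k : ℤ) where

  open Congruence n
  open ≈-Reasoning

  openPattern : ℤ → ℕ → ℤ
  openPattern a = repeat4 a k (k - a) (+ 0)

  openPattern-step : ∀ a i → openPattern a (suc (suc i)) ≡ k - openPattern a i
  openPattern-step a 0 = refl
  openPattern-step a 1 = sym (ℤ.+-inverseʳ k)
  openPattern-step a 2 = sym (k-[k-a]≡a k a)
    where
    k-[k-a]≡a : ∀ k a → k - (k - a) ≡ a
    k-[k-a]≡a = solve-∀
  openPattern-step a 3 = sym (ℤ.+-identityʳ k)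
  openPattern-step a (suc (suc (suc (suc i)))) = openPattern-step a i

  openPattern-mod4 : ∀ a m {s} → m % 4 ≡ s → openPattern a m ≡ openPattern a s
  openPattern-mod4 a m m%4≡s = trans (repeat4-mod4 a k (k - a) (+ 0) m) (cong (openPattern a) m%4≡s)

  openColoring⇒openPattern : ∀ {m} {ℓ : Fin m → ℤ} → OpenColoring n k (Path m) ℓ →
                             ∀ j → j ≤ m → extend ℓ j ≈ openPattern (extend ℓ 0) j
  openColoring⇒openPattern {m} {ℓ} oc = go
    where
    x = extend ℓ
    adjacentSum : ∀ t → t < m → previous x t + x (suc t) ≈ k
    adjacentSum t t<m = begin
      previous x t + x (suc t)              ≡⟨ cong (λ s → previous x s + x (suc s)) toℕv≡t ⟨
      previous x (toℕ v) + x (suc (toℕ v))  ≡⟨ nbSum-Path m ℓ v ⟨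
      nbSum (Path m) ℓ v                    ≈⟨ ≡[mod]⇒≈ (oc v) ⟩
      k                                     ∎
      where
      v = fromℕ< t<m
      toℕv≡t = toℕ-fromℕ< t<m
    go : ∀ j → j ≤ m → x j ≈ openPattern (x 0) j
    go 0 _ = ≈-refl
    go 1 0<m = begin
      x 1        ≡⟨ ℤ.+-identityˡ (x 1) ⟨
      + 0 + x 1  ≈⟨ adjacentSum 0 0<m ⟩
      k          ∎
    go (suc (suc i)) 1+i<m = begin
      x (suc (suc i))                  ≡⟨ cancel (x i) (x (suc (suc i))) ⟩
      x i + x (suc (suc i)) - x i      ≈⟨ +-cong (adjacentSum (suc i) 1+i<m) (-‿cong (go i i≤m)) ⟩
      k - openPattern (x 0) i          ≡⟨ openPattern-step (x 0) i ⟨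
      openPattern (x 0) (suc (suc i))  ∎
      where
      i≤m = m+n≤o⇒n≤o 2 1+i<m
      cancel : ∀ y z → z ≡ y + z - y
      cancel = solve-∀

  openPattern⇒openColoring : ∀ {m} {ℓ : Fin m → ℤ} a →
                             (∀ j → j ≤ m → extend ℓ j ≈ openPattern a j) → OpenColoring n k (Path m) ℓ
  openPattern⇒openColoring {m} {ℓ} a x≈ v = ≈⇒≡[mod] (begin
    nbSum (Path m) ℓ v                    ≡⟨ nbSum-Path m ℓ v ⟩
    previous x (toℕ v) + x (suc (toℕ v))  ≈⟨ adjacentSum (toℕ v) (toℕ<n v) ⟩
    k                                     ∎)
    where
    x = extend ℓ
    adjacentSum : ∀ t → t < m → previous x t + x (suc t) ≈ k
    adjacentSum 0 0<m = begin
      + 0 + x 1  ≡⟨ ℤ.+-identityˡ (x 1) ⟩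
      x 1        ≈⟨ x≈ 1 0<m ⟩
      k          ∎
    adjacentSum (suc i) 1+i<m = begin
      x i + x (suc (suc i))                          ≈⟨ +-cong (x≈ i i≤m) (x≈ (suc (suc i)) 1+i<m) ⟩
      openPattern a i + openPattern a (suc (suc i))  ≡⟨ cong (λ t → openPattern a i + t) (openPattern-step a i) ⟩
      openPattern a i + (k - openPattern a i)        ≡⟨ cancel (openPattern a i) k ⟩
      k                                              ∎
      where
      i≤m = m+n≤o⇒n≤o 2 1+i<m
      cancel : ∀ y k → y + (k - y) ≡ k
      cancel = solve-∀

  openColoring⇒end : ∀ {m} {ℓ : Fin m → ℤ} → OpenColoring n k (Path m) ℓ →
                     openPattern (extend ℓ 0) m ≈ + 0
  openColoring⇒end {m} {ℓ} oc = begin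
    openPattern (extend ℓ 0) m  ≈⟨ openColoring⇒openPattern oc m ≤-refl ⟨
    extend ℓ m                  ≡⟨ extend-length ℓ ⟩
    + 0                         ∎

  repeat4-openColoring : ∀ {m} a {p q r s} → p ≈ a → q ≈ k → r ≈ k - a → s ≈ + 0 →
                         openPattern a m ≈ + 0 → OpenColoring n k (Path m) (restrict (repeat4 p q r s))
  repeat4-openColoring {m} a {p} {q} {r} {s} p≈ q≈ r≈ s≈ end = openPattern⇒openColoring a x≈
    where
    x≈ : ∀ j → j ≤ m → extend (restrict {m} (repeat4 p q r s)) j ≈ openPattern a j
    x≈ j j≤m with m≤n⇒m<n∨m≡n j≤m
    ... | inj₁ j<m  =
      ≈-trans (≈-reflexive (extend-restrict (repeat4 p q r s) j<m)) (repeat4-cong p≈ q≈ r≈ s≈ j)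
    ... | inj₂ refl =
      ≈-trans (≈-reflexive (extend-length (restrict {m} (repeat4 p q r s)))) (≈-sym end)

  noOpenColoring : ¬ k ≈ + 0 → ∀ {m} (ℓ : Fin m → ℤ) → m % 4 ≡ 1 →
                   ¬ OpenColoring n k (Path m) ℓ
  noOpenColoring k≉0 {m} ℓ m%4≡1 oc = k≉0 (begin
    k                           ≡⟨ openPattern-mod4 (extend ℓ 0) m m%4≡1 ⟨
    openPattern (extend ℓ 0) m  ≈⟨ openColoring⇒end oc ⟩
    + 0                         ∎)

module PathColoring (n : ℕ) (k : ℤ) (2≤n : 2 ≤ n) (n∤k : ¬ (+ n ∣ k)) where

  open Congruence n
  open OpenColorings n k
  open ≈-Reasoning

  k≉0 : ¬ k ≈ + 0
  k≉0 k≈0 = n∤k (subst (+ n ∣_) (ℤ.+-identityʳ k) (≈⇒≡[mod] k≈0))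

  0≉k : ¬ + 0 ≈ k
  0≉k = k≉0 ∘ ≈-sym

  k+n≈k : k + + n ≈ k
  k+n≈k = begin
    k + + n  ≈⟨ +-congˡ k n≈0 ⟩
    k + + 0  ≡⟨ ℤ.+-identityʳ k ⟩
    k        ∎

  k+n≈k-0 : k + + n ≈ k - + 0
  k+n≈k-0 = ≈-trans k+n≈k (≈-reflexive (sym (ℤ.+-identityʳ k)))

  half⇒≈k-half : ∀ {a} → a + a ≈ k → a ≈ k - a
  half⇒≈k-half {a} a+a≈k = begin
    a          ≡⟨ cancel a ⟩
    a + a - a  ≈⟨ +-congʳ (- a) a+a≈k ⟩
    k - a      ∎
    where
    cancel : ∀ a → a ≡ a + a - a
    cancel = solve-∀

  ≈k-self⇒half : ∀ {a} → a ≈ k - a → a + a ≈ k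
  ≈k-self⇒half {a} a≈k-a = begin
    a + a      ≈⟨ +-congʳ a a≈k-a ⟩
    k - a + a  ≡⟨ cancel k a ⟩
    k          ∎
    where
    cancel : ∀ k a → k - a + a ≡ k
    cancel = solve-∀

  private
    2*a≡a+a : ∀ a → + 2 * a ≡ a + a
    2*a≡a+a = solve-∀

  half⇒gcd∣k : ∀ a → a + a ≈ k → + gcd 2 n ∣ k
  half⇒gcd∣k a a+a≈k = solvable⇒gcd∣ 2 (≈-trans (≈-reflexive (2*a≡a+a a)) a+a≈k)

  gcd∣k⇒half : + gcd 2 n ∣ k → ∃ λ a → a + a ≈ k
  gcd∣k⇒half gcd∣k with gcd∣⇒solvable 2 gcd∣k
  ... | a , 2a≈k = a , ≈-trans (≈-reflexive (sym (2*a≡a+a a))) 2a≈k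

  ≈0⇒¬half : ∀ {a} → a ≈ + 0 → ¬ a + a ≈ k
  ≈0⇒¬half {a} a≈0 a+a≈k = k≉0 (begin
    k      ≈⟨ a+a≈k ⟨
    a + a  ≈⟨ +-cong a≈0 a≈0 ⟩
    + 0    ∎)

  half≢0 : ∀ {a} → a + a ≈ k → a ≢ + 0
  half≢0 a+a≈k = ≉⇒≢ (λ a≈0 → ≈0⇒¬half a≈0 a+a≈k)

  half≢k : ∀ {a} → a + a ≈ k → a ≢ k
  half≢k {a} a+a≈k = ≉⇒≢ (λ a≈k → ≈0⇒¬half (a≈0 a≈k) a+a≈k)
    where
    a≈0 : a ≈ k → a ≈ + 0
    a≈0 a≈k = begin
      a      ≈⟨ half⇒≈k-half a+a≈k ⟩
      k - a  ≈⟨ +-congˡ k (-‿cong a≈k) ⟩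
      k - k  ≡⟨ ℤ.+-inverseʳ k ⟩
      + 0    ∎

  0≢n : + 0 ≢ + n
  0≢n 0≡n with subst (2 ≤_) (sym (ℤ.+-injective 0≡n)) 2≤n
  ... | ()

  k≢k+n : k ≢ k + + n
  k≢k+n k≡k+n = 0≢n (trans (sym (ℤ.+-inverseʳ k)) (trans (cong (_- k) k≡k+n) (cancel k (+ n))))
    where
    cancel : ∀ k n → k + n - k ≡ n
    cancel = solve-∀

  0≢k : + 0 ≢ k
  0≢k = ≉⇒≢ 0≉k

  0≢k+n : + 0 ≢ k + + n
  0≢k+n = distinct-residues ≈-refl k+n≈k 0≉k

  k≢n : k ≢ + n
  k≢n = distinct-residues ≈-refl n≈0 k≉0

  k+n≢n : k + + n ≢ + n
  k+n≢n = distinct-residues k+n≈k n≈0 k≉0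

  pattern₀ : ℕ → ℤ
  pattern₀ = repeat4 (+ 0) k (k + + n) (+ n)

  patternₖ : ℕ → ℤ
  patternₖ = repeat4 k (k + + n) (+ 0) (+ n)

  pattern½ : ℤ → ℕ → ℤ
  pattern½ a = repeat4 a k a (+ 0)

  pattern₀-coloring : ∀ {m} → openPattern (+ 0) m ≈ + 0 →
                      ProperOpenColoring n k (Path m) (restrict pattern₀)
  pattern₀-coloring end =
    repeat4-proper 0≢k k≢k+n k+n≢n (≢-sym 0≢n) ,
    repeat4-openColoring (+ 0) ≈-refl ≈-refl k+n≈k-0 n≈0 end

  patternₖ-coloring : ∀ {m} → openPattern k m ≈ + 0 →
                      ProperOpenColoring n k (Path m) (restrict patternₖ)
  patternₖ-coloring end =
    repeat4-proper k≢k+n (≢-sym 0≢k+n) 0≢n (≢-sym k≢n) ,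
    repeat4-openColoring k ≈-refl k+n≈k (≈-reflexive (sym (ℤ.+-inverseʳ k))) n≈0 end

  pattern½-coloring : ∀ {a m} → a + a ≈ k → m % 4 ≡ 3 →
                      ProperOpenColoring n k (Path m) (restrict (pattern½ a))
  pattern½-coloring {a} {m} a+a≈k m%4≡3 =
    repeat4-proper a≢k (≢-sym a≢k) a≢0 (≢-sym a≢0) ,
    repeat4-openColoring a ≈-refl ≈-refl (half⇒≈k-half a+a≈k) ≈-refl (≈-reflexive (openPattern-mod4 a m m%4≡3))
    where
    a≢k = half≢k a+a≈k
    a≢0 = half≢0 a+a≈k

  pattern₀-order : ∀ {M} → HasOrder (restrict {4 ℕ.+ M} pattern₀) 4
  pattern₀-order = enumeration⇒hasOrder
    ((0≢k ∷ 0≢k+n ∷ 0≢n ∷ []) ∷ (k≢k+n ∷ k≢n ∷ []) ∷ (k+n≢n ∷ []) ∷ [] ∷ [])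
    ((zero , refl) ∷ (suc zero , refl) ∷ (suc (suc zero) , refl) ∷ (suc (suc (suc zero)) , refl) ∷ [])
    (λ v → repeat4-∈ (here refl) (there (here refl)) (there (there (here refl)))
                     (there (there (there (here refl)))) (toℕ v))

  patternₖ-order : ∀ {M} → HasOrder (restrict {4 ℕ.+ M} patternₖ) 4
  patternₖ-order = enumeration⇒hasOrder
    ((0≢k ∷ 0≢k+n ∷ 0≢n ∷ []) ∷ (k≢k+n ∷ k≢n ∷ []) ∷ (k+n≢n ∷ []) ∷ [] ∷ [])
    ((suc (suc zero) , refl) ∷ (zero , refl) ∷ (suc zero , refl) ∷ (suc (suc (suc zero)) , refl) ∷ [])
    (λ v → repeat4-∈ (there (here refl)) (there (there (here refl))) (here refl)
                     (there (there (there (here refl)))) (toℕ v))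

  residue : ∀ {m} {ℓ : Fin m → ℤ} → OpenColoring n k (Path m) ℓ →
            ∀ j {j≤m : True (j ≤? m)} → extend ℓ j ≈ openPattern (extend ℓ 0) j
  residue oc j {j≤m} = openColoring⇒openPattern oc j (toWitness j≤m)

  order≥3 : ∀ {M} {ℓ : Fin (4 ℕ.+ M) → ℤ} {r} → ProperOpenColoring n k (Path (4 ℕ.+ M)) ℓ →
            HasOrder ℓ r → 3 ≤ r
  order≥3 {ℓ = ℓ} (proper , oc) =
    path⇒order≥3 {u = suc zero} {suc (suc zero)} {suc (suc (suc zero))} proper refl refl
      (distinct-residues (residue {ℓ = ℓ} oc 1) (residue {ℓ = ℓ} oc 3) k≉0)

  -- If x₀ = x₃ then x₀ ≡ 0, and x₄ ≡ x₀ takes the place of x₀ among four distinct labels.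
  four-distinct : ∀ {x₀ x₁ x₂ x₃ x₄} → ¬ x₀ + x₀ ≈ k →
                  x₁ ≈ k → x₂ ≈ k - x₀ → x₃ ≈ + 0 → x₄ ≈ x₀ →
                  x₀ ≢ x₁ → x₁ ≢ x₂ → x₂ ≢ x₃ → x₃ ≢ x₄ →
                  Unique (x₀ ∷ x₁ ∷ x₂ ∷ x₃ ∷ []) ⊎ Unique (x₄ ∷ x₁ ∷ x₂ ∷ x₃ ∷ [])
  four-distinct {x₀} {x₁} {x₂} {x₃} {x₄} ¬half x₁≈k x₂≈k-x₀ x₃≈0 x₄≈x₀ x₀≢x₁ x₁≢x₂ x₂≢x₃ x₃≢x₄ =
    decide (x₀ ℤ.≟ x₃)
    where
    x₀≉k-x₀ : ¬ x₀ ≈ k - x₀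
    x₀≉k-x₀ = ¬half ∘ ≈k-self⇒half
    x₀≢x₂ : x₀ ≢ x₂
    x₀≢x₂ = distinct-residues ≈-refl x₂≈k-x₀ x₀≉k-x₀
    x₁≢x₃ : x₁ ≢ x₃
    x₁≢x₃ = distinct-residues x₁≈k x₃≈0 k≉0
    decide : Dec (x₀ ≡ x₃) → Unique (x₀ ∷ x₁ ∷ x₂ ∷ x₃ ∷ []) ⊎ Unique (x₄ ∷ x₁ ∷ x₂ ∷ x₃ ∷ [])
    decide (no x₀≢x₃) = inj₁
      ((x₀≢x₁ ∷ x₀≢x₂ ∷ x₀≢x₃ ∷ []) ∷ (x₁≢x₂ ∷ x₁≢x₃ ∷ []) ∷ (x₂≢x₃ ∷ []) ∷ [] ∷ [])
    decide (yes x₀≡x₃) = inj₂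
      ((x₄≢x₁ ∷ x₄≢x₂ ∷ ≢-sym x₃≢x₄ ∷ []) ∷ (x₁≢x₂ ∷ x₁≢x₃ ∷ []) ∷ (x₂≢x₃ ∷ []) ∷ [] ∷ [])
      where
      x₄≢x₁ : x₄ ≢ x₁
      x₄≢x₁ = distinct-residues (≈-trans x₄≈x₀ (subst (_≈ + 0) (sym x₀≡x₃) x₃≈0)) x₁≈k 0≉k
      x₄≢x₂ : x₄ ≢ x₂
      x₄≢x₂ = distinct-residues x₄≈x₀ x₂≈k-x₀ x₀≉k-x₀

  order≥4 : ∀ {M} {ℓ : Fin (5 ℕ.+ M) → ℤ} {r} → ProperOpenColoring n k (Path (5 ℕ.+ M)) ℓ →
            ¬ ℓ zero + ℓ zero ≈ k → HasOrder ℓ r → 4 ≤ r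
  order≥4 {M} {ℓ} (proper , oc) ¬half =
    [ (λ unique → length≤order unique ((v₀ , refl) ∷ (v₁ , refl) ∷ (v₂ , refl) ∷ (v₃ , refl) ∷ []))
    , (λ unique → length≤order unique ((v₄ , refl) ∷ (v₁ , refl) ∷ (v₂ , refl) ∷ (v₃ , refl) ∷ []))
    ]′ (four-distinct ¬half (residueₗ 1) (residueₗ 2) (residueₗ 3) (residueₗ 4)
                      (proper v₀ v₁ refl) (proper v₁ v₂ refl) (proper v₂ v₃ refl) (proper v₃ v₄ refl))
    where
    v₀ v₁ v₂ v₃ v₄ : Fin (5 ℕ.+ M)
    v₀ = zero
    v₁ = suc zero
    v₂ = suc (suc zero)
    v₃ = suc (suc (suc zero))
    v₄ = suc (suc (suc (suc zero)))
    residueₗ = residue {ℓ = ℓ} oc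

  FourColorCase : ℕ → Set
  FourColorCase m = m % 4 ≡ 0 ⊎ m % 4 ≡ 2 ⊎ (m % 4 ≡ 3 × ¬ (+ gcd 2 n ∣ k))

  fourColorCase : ∀ m → ¬ (m % 4 ≡ 3 × + gcd 2 n ∣ k) → ¬ m % 4 ≡ 1 → FourColorCase m
  fourColorCase m ¬[≡3×gcd∣k] ≢1 with mod4-cases m
  ... | inj₁ ≡0               = inj₁ ≡0
  ... | inj₂ (inj₁ ≡1)        = ⊥-elim (≢1 ≡1)
  ... | inj₂ (inj₂ (inj₁ ≡2)) = inj₂ (inj₁ ≡2)
  ... | inj₂ (inj₂ (inj₂ ≡3)) = inj₂ (inj₂ (≡3 , λ gcd∣k → ¬[≡3×gcd∣k] (≡3 , gcd∣k)))

  fourColorCase⇒¬half : ∀ {m} {ℓ : Fin m → ℤ} → FourColorCase m → OpenColoring n k (Path m) ℓ →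
                        ¬ extend ℓ 0 + extend ℓ 0 ≈ k
  fourColorCase⇒¬half {m} {ℓ} (inj₁ m%4≡0) oc = ≈0⇒¬half (begin
    a                ≡⟨ openPattern-mod4 a m m%4≡0 ⟨
    openPattern a m  ≈⟨ openColoring⇒end oc ⟩
    + 0              ∎)
    where a = extend ℓ 0
  fourColorCase⇒¬half {m} {ℓ} (inj₂ (inj₁ m%4≡2)) oc a+a≈k = ≈0⇒¬half (begin
    a                ≈⟨ half⇒≈k-half a+a≈k ⟩
    k - a            ≡⟨ openPattern-mod4 a m m%4≡2 ⟨
    openPattern a m  ≈⟨ openColoring⇒end oc ⟩
    + 0              ∎) a+a≈k
    where a = extend ℓ 0
  fourColorCase⇒¬half {ℓ = ℓ} (inj₂ (inj₂ (_ , ¬gcd∣k))) _ = ¬gcd∣k ∘ half⇒gcd∣k (extend ℓ 0)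

  χ[P₂]≡2 : ChiEq n k (Path 2) 2
  χ[P₂]≡2 =
    (restrict patternₖ , patternₖ-coloring {2} (≈-reflexive (ℤ.+-inverseʳ k)) ,
     enumeration⇒hasOrder ((k≢k+n ∷ []) ∷ [] ∷ []) ((zero , refl) ∷ (suc zero , refl) ∷ [])
       λ { zero → here refl ; (suc zero) → there (here refl) ; (suc (suc ())) }) ,
    λ ℓ r (proper , _) → edge⇒order≥2 {u = zero} {suc zero} proper refl

  χ[P₃]≡2 : + gcd 2 n ∣ k → ChiEq n k (Path 3) 2
  χ[P₃]≡2 gcd∣k =
    let a , a+a≈k = gcd∣k⇒half gcd∣k in
    (restrict (pattern½ a) , pattern½-coloring {m = 3} a+a≈k refl ,
     enumeration⇒hasOrder ((half≢k a+a≈k ∷ []) ∷ [] ∷ []) ((zero , refl) ∷ (suc zero , refl) ∷ [])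
       λ { zero → here refl ; (suc zero) → there (here refl) ; (suc (suc zero)) → here refl
         ; (suc (suc (suc ()))) }) ,
    λ ℓ r (proper , _) → edge⇒order≥2 {u = zero} {suc zero} proper refl

  χ[P₃]≡3 : ¬ (+ gcd 2 n ∣ k) → ChiEq n k (Path 3) 3
  χ[P₃]≡3 ¬gcd∣k =
    (restrict pattern₀ , pattern₀-coloring {3} ≈-refl ,
     enumeration⇒hasOrder ((0≢k ∷ 0≢k+n ∷ []) ∷ (k≢k+n ∷ []) ∷ [] ∷ [])
       ((zero , refl) ∷ (suc zero , refl) ∷ (suc (suc zero) , refl) ∷ [])
       λ { zero → here refl ; (suc zero) → there (here refl) ; (suc (suc zero)) → there (there (here refl))
         ; (suc (suc (suc ()))) }) ,
    λ ℓ r (proper , oc) → path⇒order≥3 {u = zero} {suc zero} {suc (suc zero)} proper refl refl (ends-distinct {ℓ} oc)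
    where
    ends-distinct : ∀ {ℓ} → OpenColoring n k (Path 3) ℓ → ℓ zero ≢ ℓ (suc (suc zero))
    ends-distinct {ℓ} oc ℓ₀≡ℓ₂ =
      ¬gcd∣k (half⇒gcd∣k (ℓ zero) (≈k-self⇒half (≈-trans (≈-reflexive ℓ₀≡ℓ₂) (residue {ℓ = ℓ} oc 2))))

  χ[P₄]≡3 : ChiEq n k (Path 4) 3
  χ[P₄]≡3 =
    (restrict x ,
     (consecutive⇒proper 4 x consecutive , repeat4-openColoring {4} (+ 0) ≈-refl ≈-refl k+n≈k-0 ≈-refl ≈-refl) ,
     enumeration⇒hasOrder ((0≢k ∷ 0≢k+n ∷ []) ∷ (k≢k+n ∷ []) ∷ [] ∷ [])
       ((zero , refl) ∷ (suc zero , refl) ∷ (suc (suc zero) , refl) ∷ [])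
       (λ v → repeat4-∈ (here refl) (there (here refl)) (there (there (here refl))) (here refl) (toℕ v))) ,
    λ ℓ r → order≥3
    where
    x : ℕ → ℤ
    x = repeat4 (+ 0) k (k + + n) (+ 0)
    consecutive : ∀ i → suc i < 4 → x i ≢ x (suc i)
    consecutive 0 _ = 0≢k
    consecutive 1 _ = k≢k+n
    consecutive 2 _ = ≢-sym 0≢k+n
    consecutive (suc (suc (suc _))) (s≤s (s≤s (s≤s (s≤s ()))))

  χ[Pₘ]≡3 : ∀ {M} → (4 ℕ.+ M) % 4 ≡ 3 → + gcd 2 n ∣ k → ChiEq n k (Path (4 ℕ.+ M)) 3
  χ[Pₘ]≡3 {M} m%4≡3 gcd∣k =
    let a , a+a≈k = gcd∣k⇒half gcd∣k in
    (restrict (pattern½ a) , pattern½-coloring {m = 4 ℕ.+ M} a+a≈k m%4≡3 ,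
     enumeration⇒hasOrder ((half≢k a+a≈k ∷ half≢0 a+a≈k ∷ []) ∷ (≢-sym 0≢k ∷ []) ∷ [] ∷ [])
       ((zero , refl) ∷ (suc zero , refl) ∷ (suc (suc (suc zero)) , refl) ∷ [])
       (λ v → repeat4-∈ (here refl) (there (here refl)) (here refl) (there (there (here refl))) (toℕ v))) ,
    λ ℓ r → order≥3

  χ[Pₘ]-undefined : ∀ {m} → m % 4 ≡ 1 → ChiDNE n k (Path m)
  χ[Pₘ]-undefined m%4≡1 ℓ (_ , oc) = noOpenColoring k≉0 ℓ m%4≡1 oc

  χ[Pₘ]≡4 : ∀ {M} → FourColorCase (5 ℕ.+ M) → ChiEq n k (Path (5 ℕ.+ M)) 4
  χ[Pₘ]≡4 {M} case =
    coloring case ,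
    λ ℓ r (proper , oc) → order≥4 (proper , oc) (fourColorCase⇒¬half {ℓ = ℓ} case oc)
    where
    m = 5 ℕ.+ M
    coloring : FourColorCase m → ∃ λ ℓ → ProperOpenColoring n k (Path m) ℓ × HasOrder ℓ 4
    coloring (inj₁ m%4≡0) =
      restrict pattern₀ , pattern₀-coloring {m} (≈-reflexive (openPattern-mod4 (+ 0) m m%4≡0)) , pattern₀-order
    coloring (inj₂ (inj₁ m%4≡2)) =
      restrict patternₖ ,
      patternₖ-coloring {m} (≈-trans (≈-reflexive (openPattern-mod4 k m m%4≡2)) (≈-reflexive (ℤ.+-inverseʳ k))) ,
      patternₖ-order
    coloring (inj₂ (inj₂ (m%4≡3 , _))) =
      restrict pattern₀ , pattern₀-coloring {m} (≈-reflexive (openPattern-mod4 (+ 0) m m%4≡3)) , pattern₀-order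

theorem6p1 : (k : ℤ) (n : ℕ) → 2 ≤ n → ¬ ((+ n) ∣ k) →
    ChiEq n k (Path 2) 2
    × ((+ gcd 2 n ∣ k → ChiEq n k (Path 3) 2)
    × (¬ (+ gcd 2 n ∣ k) → ChiEq n k (Path 3) 3))
    × ChiEq n k (Path 4) 3
    × ((m : ℕ) → 5 ≤ m →
    ((m % 4 ≡ 3 → + gcd 2 n ∣ k → ChiEq n k (Path m) 3)
    × (m % 4 ≡ 1 → ChiDNE n k (Path m))
    × (¬ (m % 4 ≡ 3 × + gcd 2 n ∣ k) → ¬ (m % 4 ≡ 1) → ChiEq n k (Path m) 4)))
theorem6p1 k n 2≤n n∤k =
  χ[P₂]≡2 , (χ[P₃]≡2 , χ[P₃]≡3) , χ[P₄]≡3 ,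
  λ { m (s≤s (s≤s (s≤s (s≤s (s≤s (z≤n {M})))))) →
        χ[Pₘ]≡3 {suc M} , χ[Pₘ]-undefined ,
        λ ¬[≡3×gcd∣k] ≢1 → χ[Pₘ]≡4 {M} (fourColorCase m ¬[≡3×gcd∣k] ≢1) }
  where open PathColoring n k 2≤n n∤k
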